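{- Let $p$ be a prime, let $g$ be a primitive root modulo $p$ (a generator of the multiplicative group of $\mathbb{Z}/p\mathbb{Z}$), and for an integer $t$ let $r(t)\in\{0,1,\dots,p-1\}$ denote the residue of $t$ modulo $p$. Let $S'=\{(4k-3,\,r(g^{k})) : k=1,\dots,p-1\}\subset\mathbb{Z}\times\mathbb{Z}$. Then for every four distinct elements $a,b,c,d\in S'$ and every choice of signs: (1) $\pm a\pm b\pm c\pm d\neq(0,0)$; (2) the absolute value of the first coordinate of $\pm a\pm b\pm c\pm d$ does not exceed $16p$, and the absolute value of its second coordinate does not exceed $4p$. -}

module Defs where

open import Data.Nat as ℕ using (ℕ; _^_; _%_; _≤_; _<_; _∸_)
open import Data.Nat.Primality using (Prime)
open import Data.Integer as ℤ using (ℤ; +_; -_; ∣_∣)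
open import Data.Product using (_×_; _,_; ∃-syntax; proj₁; proj₂)
open import Data.Bool using (Bool; true; false)
open import Relation.Binary.PropositionalEquality using (_≡_)
open import Relation.Nullary using (¬_)

IsPrimitiveRoot : (p : ℕ) → .{{_ : ℕ.NonZero p}} → ℕ → Set
IsPrimitiveRoot p g =
  ¬ (g % p ≡ 0) ×
  (∀ (x : ℕ) → ¬ (x % p ≡ 0) → ∃[ k ] (g ^ k % p ≡ x % p))

Point : Set
Point = ℤ × ℤ

pt : (p : ℕ) → .{{_ : ℕ.NonZero p}} → ℕ → ℕ → Point
pt p g k = (+ (4 ℕ.* k) ℤ.- + 3) , + (g ^ k % p)

InS' : (p : ℕ) → .{{_ : ℕ.NonZero p}} → ℕ → Point → Set
InS' p g a = ∃[ k ] (1 ≤ k × k ≤ p ∸ 1 × a ≡ pt p g k)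

applySign : Bool → Point → Point
applySign true  a = a
applySign false (x , y) = (- x , - y)

_⊕_ : Point → Point → Point
(x , y) ⊕ (x' , y') = (x ℤ.+ x' , y ℤ.+ y')
infixl 6 _⊕_

signedSum : Bool → Bool → Bool → Bool → Point → Point → Point → Point → Point
signedSum s₁ s₂ s₃ s₄ a b c d =
  applySign s₁ a ⊕ applySign s₂ b ⊕ applySign s₃ c ⊕ applySign s₄ d

module Submission where

-- The bounds: first coordinates lie in [1, 4p], second coordinates in [0, p].  For
-- non-vanishing, a vanishing signed sum means that its positive and negative parts agree
-- in both coordinates (Balanced).  First coordinates are ≡ 1 (mod 4), so both parts have
-- two points (one-sided sums are positive, three against one fails mod 4).  Two against
-- two gives k₁ + k₂ = k₃ + k₄ and r(g^k₁) + r(g^k₂) = r(g^k₃) + r(g^k₄), hence also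
-- r(g^k₁) r(g^k₂) ≡ r(g^k₃) r(g^k₄) (mod p); by (A − C)(A − D) = CD − AB for A + B = C + D,
-- r(g^k₁) equals r(g^k₃) or r(g^k₄), and injectivity of k ↦ r(g^k) on 1, …, p − 1
-- (g has order p − 1) contradicts distinctness.

open import Defs
open import Data.Nat as ℕ using (ℕ; zero; suc; _+_; _*_; _∸_; _^_; _%_; _/_; _≤_; _<_; NonZero; z≤n; s≤s)
import Data.Nat.Properties as ℕₚ
open import Data.Nat.DivMod using (m%n%n≡m%n; m%n≤n; m<n⇒m%n≡m; %-distribˡ-*; %-remove-+ˡ; [m+kn]%n≡m%n)
open import Data.Nat.Divisibility using (_∣_; divides; ∣1⇒≡1; n∣m⇒m%n≡0)
open import Data.Nat.Primality using (Prime; prime⇒nonZero; euclidsLemma; ¬prime[1])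
import Data.Nat.Tactic.RingSolver as ℕ-Solver
open import Data.Integer as ℤ using (ℤ; +_; -_; ∣_∣)
import Data.Integer.Properties as ℤₚ
open import Data.Integer.DivMod using (a≡a%ℕn+[a/ℕn]*n)
import Data.Integer.Tactic.RingSolver as ℤ-Solver
open import Data.Fin using (Fin; toℕ; fromℕ<)
open import Data.Fin.Properties using (toℕ<n; toℕ-fromℕ<; toℕ-injective; injective⇒≤)
open import Data.Product using (_×_; _,_; proj₁; proj₂; ∃-syntax)
open import Data.Sum as Sum using (_⊎_; inj₁; inj₂)
open import Data.Bool using (Bool; true; false; not)
open import Data.Empty using (⊥; ⊥-elim)
open import Relation.Nullary using (¬_; yes; no)
open import Relation.Binary using (tri<; tri≈; tri>)
open import Relation.Binary.PropositionalEquality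

module _ {n : ℕ} .{{_ : NonZero n}} where

  %-≡⇒∣- : ∀ m k → m % n ≡ k % n → n ∣ ∣ + m ℤ.- + k ∣
  %-≡⇒∣- m k eq = divides ∣ + (m / n) ℤ.- + (k / n) ∣ (begin
      ∣ + m ℤ.- + k ∣
        ≡⟨ cong₂ (λ x y → ∣ x ℤ.- y ∣) (a≡a%ℕn+[a/ℕn]*n (+ m) n) (a≡a%ℕn+[a/ℕn]*n (+ k) n) ⟩
      ∣ (+ (m % n) ℤ.+ + (m / n) ℤ.* + n) ℤ.- (+ (k % n) ℤ.+ + (k / n) ℤ.* + n) ∣
        ≡⟨ cong (λ r → ∣ (+ r ℤ.+ + (m / n) ℤ.* + n) ℤ.- (+ (k % n) ℤ.+ + (k / n) ℤ.* + n) ∣) eq ⟩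
      ∣ (+ (k % n) ℤ.+ + (m / n) ℤ.* + n) ℤ.- (+ (k % n) ℤ.+ + (k / n) ℤ.* + n) ∣
        ≡⟨ cong ∣_∣ (cancel (+ (k % n)) (+ (m / n)) (+ (k / n)) (+ n)) ⟩
      ∣ (+ (m / n) ℤ.- + (k / n)) ℤ.* + n ∣
        ≡⟨ ℤₚ.abs-* (+ (m / n) ℤ.- + (k / n)) (+ n) ⟩
      ∣ + (m / n) ℤ.- + (k / n) ∣ * n ∎)
    where
    open ≡-Reasoning
    cancel : ∀ r x y z → (r ℤ.+ x ℤ.* z) ℤ.- (r ℤ.+ y ℤ.* z) ≡ (x ℤ.- y) ℤ.* z
    cancel = ℤ-Solver.solve-∀

  ∣∸⇒%-≡ : ∀ {m k} → k ≤ m → n ∣ ∣ + m ℤ.- + k ∣ → m % n ≡ k % n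
  ∣∸⇒%-≡ {m} {k} k≤m n∣m-k = begin
    m % n           ≡⟨ cong (_% n) (sym (ℕₚ.m∸n+n≡m k≤m)) ⟩
    (m ∸ k + k) % n ≡⟨ %-remove-+ˡ k (subst (n ∣_) distance n∣m-k) ⟩
    k % n           ∎
    where
    open ≡-Reasoning
    distance : ∣ + m ℤ.- + k ∣ ≡ m ∸ k
    distance = cong ∣_∣ (trans (ℤₚ.m-n≡m⊖n m k) (ℤₚ.⊖-≥ k≤m))

  ∣-⇒%-≡ : ∀ m k → n ∣ ∣ + m ℤ.- + k ∣ → m % n ≡ k % n
  ∣-⇒%-≡ m k n∣m-k with ℕₚ.≤-total k m
  ... | inj₁ k≤m = ∣∸⇒%-≡ k≤m n∣m-k
  ... | inj₂ m≤k = sym (∣∸⇒%-≡ m≤k (subst (n ∣_) (ℤₚ.∣i-j∣≡∣j-i∣ (+ m) (+ k)) n∣m-k))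

  *-congˡ-% : ∀ x {y z} → y % n ≡ z % n → (x * y) % n ≡ (x * z) % n
  *-congˡ-% x {y} {z} eq = begin
    (x * y) % n             ≡⟨ %-distribˡ-* x y n ⟩
    (x % n * (y % n)) % n   ≡⟨ cong (λ r → (x % n * r) % n) eq ⟩
    (x % n * (z % n)) % n   ≡⟨ %-distribˡ-* x z n ⟨
    (x * z) % n             ∎
    where open ≡-Reasoning

  powers-cycle : ∀ g {d} → 0 < d → g ^ d % n ≡ 1 % n → ∀ k → ∃[ m ] (m < d × g ^ k % n ≡ g ^ m % n)
  powers-cycle g 0<d gᵈ≡1 zero = 0 , 0<d , refl
  powers-cycle g {d} 0<d gᵈ≡1 (suc k) with powers-cycle g 0<d gᵈ≡1 k
  ... | m , m<d , gᵏ≡gᵐ with suc m ℕ.<? d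
  ...   | yes m+1<d = suc m , m+1<d , *-congˡ-% g gᵏ≡gᵐ
  ...   | no  m+1≮d = 0 , 0<d , trans (*-congˡ-% g gᵏ≡gᵐ) (trans (cong (λ e → g ^ e % n) m+1≡d) gᵈ≡1)
    where
    m+1≡d : suc m ≡ d
    m+1≡d = ℕₚ.≤-antisym m<d (ℕₚ.≮⇒≥ m+1≮d)

-- For A + B = C + D one has (A − C)(A − D) = CD − AB: both C and D are roots of
-- the quadratic with roots A and B.
vieta : ∀ (A B C D : ℤ) → A ℤ.+ B ≡ C ℤ.+ D → (A ℤ.- C) ℤ.* (A ℤ.- D) ≡ C ℤ.* D ℤ.- A ℤ.* B
vieta A B C D sum = begin
  (A ℤ.- C) ℤ.* (A ℤ.- D)                 ≡⟨ expand A C D ⟩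
  C ℤ.* D ℤ.- A ℤ.* ((C ℤ.+ D) ℤ.- A)     ≡⟨ cong (λ x → C ℤ.* D ℤ.- A ℤ.* (x ℤ.- A)) sum ⟨
  C ℤ.* D ℤ.- A ℤ.* ((A ℤ.+ B) ℤ.- A)     ≡⟨ cong (λ x → C ℤ.* D ℤ.- A ℤ.* x) (cancel A B) ⟩
  C ℤ.* D ℤ.- A ℤ.* B                     ∎
  where
  open ≡-Reasoning
  expand : ∀ x y z → (x ℤ.- y) ℤ.* (x ℤ.- z) ≡ y ℤ.* z ℤ.- x ℤ.* ((y ℤ.+ z) ℤ.- x)
  expand = ℤ-Solver.solve-∀
  cancel : ∀ x y → (x ℤ.+ y) ℤ.- x ≡ y
  cancel = ℤ-Solver.solve-∀

module _ {p : ℕ} (pp : Prime p) where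
  private instance
    p≢0 : NonZero p
    p≢0 = prime⇒nonZero pp

  ∤⇒∤^ : ∀ {x} → ¬ p ∣ x → ∀ k → ¬ p ∣ x ^ k
  ∤⇒∤^ p∤x zero    p∣1 = ¬prime[1] (subst Prime (∣1⇒≡1 p∣1) pp)
  ∤⇒∤^ p∤x (suc k) p∣xᵏ⁺¹ with euclidsLemma _ _ pp p∣xᵏ⁺¹
  ... | inj₁ p∣x  = p∤x p∣x
  ... | inj₂ p∣xᵏ = ∤⇒∤^ p∤x k p∣xᵏ

  *-cancelˡ-% : ∀ {x} y z → ¬ p ∣ x → (x * y) % p ≡ (x * z) % p → y % p ≡ z % p
  *-cancelˡ-% {x} y z p∤x eq
    with euclidsLemma x _ pp (subst (p ∣_) factor (%-≡⇒∣- (x * y) (x * z) eq))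
    where
    factor : ∣ + (x * y) ℤ.- + (x * z) ∣ ≡ x * ∣ + y ℤ.- + z ∣
    factor = begin
      ∣ + (x * y) ℤ.- + (x * z) ∣       ≡⟨ cong₂ (λ u v → ∣ u ℤ.- v ∣) (ℤₚ.pos-* x y) (ℤₚ.pos-* x z) ⟩
      ∣ + x ℤ.* + y ℤ.- + x ℤ.* + z ∣   ≡⟨ cong ∣_∣ (distrib (+ x) (+ y) (+ z)) ⟩
      ∣ + x ℤ.* (+ y ℤ.- + z) ∣         ≡⟨ ℤₚ.abs-* (+ x) (+ y ℤ.- + z) ⟩
      x * ∣ + y ℤ.- + z ∣               ∎
      where
      open ≡-Reasoning
      distrib : ∀ u v w → u ℤ.* v ℤ.- u ℤ.* w ≡ u ℤ.* (v ℤ.- w)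
      distrib = ℤ-Solver.solve-∀
  ... | inj₁ p∣x   = ⊥-elim (p∤x p∣x)
  ... | inj₂ p∣y-z = ∣-⇒%-≡ y z p∣y-z

  two-roots : ∀ A B C D → A ℤ.+ B ≡ C ℤ.+ D → p ∣ ∣ C ℤ.* D ℤ.- A ℤ.* B ∣ →
              (p ∣ ∣ A ℤ.- C ∣) ⊎ (p ∣ ∣ A ℤ.- D ∣)
  two-roots A B C D sum p∣CD-AB = euclidsLemma _ _ pp (subst (p ∣_) product p∣CD-AB)
    where
    product : ∣ C ℤ.* D ℤ.- A ℤ.* B ∣ ≡ ∣ A ℤ.- C ∣ * ∣ A ℤ.- D ∣
    product = trans (cong ∣_∣ (sym (vieta A B C D sum))) (ℤₚ.abs-* (A ℤ.- C) (A ℤ.- D))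

signed : Bool → ℤ → ℤ
signed true  x = x
signed false x = - x

signedSumℤ : Bool → Bool → Bool → Bool → ℤ → ℤ → ℤ → ℤ → ℤ
signedSumℤ s₁ s₂ s₃ s₄ x₁ x₂ x₃ x₄ = signed s₁ x₁ ℤ.+ signed s₂ x₂ ℤ.+ signed s₃ x₃ ℤ.+ signed s₄ x₄

applySign-coords : ∀ s (a : Point) → applySign s a ≡ (signed s (proj₁ a) , signed s (proj₂ a))
applySign-coords true  a = refl
applySign-coords false a = refl

signedSum-coords : ∀ s₁ s₂ s₃ s₄ (a b c d : Point) → signedSum s₁ s₂ s₃ s₄ a b c d ≡
  ( signedSumℤ s₁ s₂ s₃ s₄ (proj₁ a) (proj₁ b) (proj₁ c) (proj₁ d)
  , signedSumℤ s₁ s₂ s₃ s₄ (proj₂ a) (proj₂ b) (proj₂ c) (proj₂ d))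
signedSum-coords s₁ s₂ s₃ s₄ a b c d
  rewrite applySign-coords s₁ a | applySign-coords s₂ b | applySign-coords s₃ c | applySign-coords s₄ d = refl

∣signedSumℤ∣≤ : ∀ s₁ s₂ s₃ s₄ x₁ x₂ x₃ x₄ K → ∣ x₁ ∣ ≤ K → ∣ x₂ ∣ ≤ K → ∣ x₃ ∣ ≤ K → ∣ x₄ ∣ ≤ K →
                ∣ signedSumℤ s₁ s₂ s₃ s₄ x₁ x₂ x₃ x₄ ∣ ≤ 4 * K
∣signedSumℤ∣≤ s₁ s₂ s₃ s₄ x₁ x₂ x₃ x₄ K h₁ h₂ h₃ h₄ =
  subst (∣ u₁ ℤ.+ u₂ ℤ.+ u₃ ℤ.+ u₄ ∣ ≤_) (four K)
    (∣+∣≤ (u₁ ℤ.+ u₂ ℤ.+ u₃) u₄ (∣+∣≤ (u₁ ℤ.+ u₂) u₃ (∣+∣≤ u₁ u₂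
      (∣signed∣≤ s₁ x₁ h₁) (∣signed∣≤ s₂ x₂ h₂)) (∣signed∣≤ s₃ x₃ h₃)) (∣signed∣≤ s₄ x₄ h₄))
  where
  u₁ u₂ u₃ u₄ : ℤ
  u₁ = signed s₁ x₁
  u₂ = signed s₂ x₂
  u₃ = signed s₃ x₃
  u₄ = signed s₄ x₄
  ∣signed∣≤ : ∀ s x → ∣ x ∣ ≤ K → ∣ signed s x ∣ ≤ K
  ∣signed∣≤ true  x h = h
  ∣signed∣≤ false x h = subst (_≤ K) (sym (ℤₚ.∣-i∣≡∣i∣ x)) h
  ∣+∣≤ : ∀ x y {L M} → ∣ x ∣ ≤ L → ∣ y ∣ ≤ M → ∣ x ℤ.+ y ∣ ≤ L + M
  ∣+∣≤ x y hx hy = ℕₚ.≤-trans (ℤₚ.∣i+j∣≤∣i∣+∣j∣ x y) (ℕₚ.+-mono-≤ hx hy)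
  four : ∀ K → K + K + K + K ≡ 4 * K
  four = ℕ-Solver.solve-∀

addIf : Bool → ℕ → ℕ → ℕ
addIf true  n acc = n + acc
addIf false n acc = acc

plusPart : Bool → Bool → Bool → Bool → ℕ → ℕ → ℕ → ℕ → ℕ
plusPart s₁ s₂ s₃ s₄ n₁ n₂ n₃ n₄ = addIf s₁ n₁ (addIf s₂ n₂ (addIf s₃ n₃ (addIf s₄ n₄ 0)))

-- ±n₁ ± n₂ ± n₃ ± n₄ = 0, stated in ℕ: the positive and the negative part agree.
Balanced : Bool → Bool → Bool → Bool → ℕ → ℕ → ℕ → ℕ → Set
Balanced s₁ s₂ s₃ s₄ n₁ n₂ n₃ n₄ =
  plusPart s₁ s₂ s₃ s₄ n₁ n₂ n₃ n₄ ≡ plusPart (not s₁) (not s₂) (not s₃) (not s₄) n₁ n₂ n₃ n₄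

signedSumℤ≡plus-minus : ∀ s₁ s₂ s₃ s₄ n₁ n₂ n₃ n₄ →
  signedSumℤ s₁ s₂ s₃ s₄ (+ n₁) (+ n₂) (+ n₃) (+ n₄) ≡
  + plusPart s₁ s₂ s₃ s₄ n₁ n₂ n₃ n₄ ℤ.- + plusPart (not s₁) (not s₂) (not s₃) (not s₄) n₁ n₂ n₃ n₄
signedSumℤ≡plus-minus s₁ s₂ s₃ s₄ n₁ n₂ n₃ n₄ = sym (begin
  + addIf s₁ n₁ (addIf s₂ n₂ (addIf s₃ n₃ (addIf s₄ n₄ 0)))
    ℤ.- + addIf (not s₁) n₁ (addIf (not s₂) n₂ (addIf (not s₃) n₃ (addIf (not s₄) n₄ 0)))
      ≡⟨ peel s₁ n₁ _ _ ⟩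
  u₁ ℤ.+ (+ addIf s₂ n₂ (addIf s₃ n₃ (addIf s₄ n₄ 0))
    ℤ.- + addIf (not s₂) n₂ (addIf (not s₃) n₃ (addIf (not s₄) n₄ 0)))
      ≡⟨ cong (λ x → u₁ ℤ.+ x) (peel s₂ n₂ _ _) ⟩
  u₁ ℤ.+ (u₂ ℤ.+ (+ addIf s₃ n₃ (addIf s₄ n₄ 0) ℤ.- + addIf (not s₃) n₃ (addIf (not s₄) n₄ 0)))
      ≡⟨ cong (λ x → u₁ ℤ.+ (u₂ ℤ.+ x)) (peel s₃ n₃ _ _) ⟩
  u₁ ℤ.+ (u₂ ℤ.+ (u₃ ℤ.+ (+ addIf s₄ n₄ 0 ℤ.- + addIf (not s₄) n₄ 0)))
      ≡⟨ cong (λ x → u₁ ℤ.+ (u₂ ℤ.+ (u₃ ℤ.+ x))) (peel s₄ n₄ 0 0) ⟩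
  u₁ ℤ.+ (u₂ ℤ.+ (u₃ ℤ.+ (u₄ ℤ.+ (+ 0 ℤ.- + 0))))
      ≡⟨ reassociate u₁ u₂ u₃ u₄ ⟩
  u₁ ℤ.+ u₂ ℤ.+ u₃ ℤ.+ u₄ ∎)
  where
  open ≡-Reasoning
  u₁ u₂ u₃ u₄ : ℤ
  u₁ = signed s₁ (+ n₁)
  u₂ = signed s₂ (+ n₂)
  u₃ = signed s₃ (+ n₃)
  u₄ = signed s₄ (+ n₄)
  peel : ∀ s n acc acc′ → + addIf s n acc ℤ.- + addIf (not s) n acc′ ≡ signed s (+ n) ℤ.+ (+ acc ℤ.- + acc′)
  peel true  n acc acc′ = trans (cong (λ x → x ℤ.- + acc′) (ℤₚ.pos-+ n acc)) (shift (+ n) (+ acc) (+ acc′))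
    where
    shift : ∀ x y z → (x ℤ.+ y) ℤ.- z ≡ x ℤ.+ (y ℤ.- z)
    shift = ℤ-Solver.solve-∀
  peel false n acc acc′ = trans (cong (λ x → + acc ℤ.- x) (ℤₚ.pos-+ n acc′)) (shift (+ n) (+ acc) (+ acc′))
    where
    shift : ∀ x y z → y ℤ.- (x ℤ.+ z) ≡ ℤ.- x ℤ.+ (y ℤ.- z)
    shift = ℤ-Solver.solve-∀
  reassociate : ∀ x y z w → x ℤ.+ (y ℤ.+ (z ℤ.+ (w ℤ.+ (+ 0 ℤ.- + 0)))) ≡ x ℤ.+ y ℤ.+ z ℤ.+ w
  reassociate = ℤ-Solver.solve-∀

vanishing⇒balanced : ∀ s₁ s₂ s₃ s₄ n₁ n₂ n₃ n₄ → signedSumℤ s₁ s₂ s₃ s₄ (+ n₁) (+ n₂) (+ n₃) (+ n₄) ≡ ℤ.0ℤ →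
                     Balanced s₁ s₂ s₃ s₄ n₁ n₂ n₃ n₄
vanishing⇒balanced s₁ s₂ s₃ s₄ n₁ n₂ n₃ n₄ vanishes =
  ℤₚ.+-injective (ℤₚ.i-j≡0⇒i≡j _ _ (trans (sym (signedSumℤ≡plus-minus s₁ s₂ s₃ s₄ n₁ n₂ n₃ n₄)) vanishes))

-- 4(j + 1) − 3, the first coordinate of the point of S' with index k = j + 1.
firstCoord : ℕ → ℕ
firstCoord j = suc (4 * j)

firstCoord≤ : ∀ {j m} → j < m → firstCoord j ≤ 4 * m
firstCoord≤ j<m = ℕₚ.*-monoʳ-< 4 j<m

-- Values ≡ 1 (mod 4): three of them never sum to a single one …
three≢one : ∀ a b c d → ¬ Balanced true true true false (firstCoord a) (firstCoord b) (firstCoord c) (firstCoord d)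
three≢one a b c d balanced = 3≢1 (begin
  3                         ≡⟨ [m+kn]%n≡m%n 3 (a + b + c) 4 ⟨
  (3 + (a + b + c) * 4) % 4 ≡⟨ cong (_% 4) (trans (sym (lhs a b c)) (trans balanced (rhs d))) ⟩
  (1 + d * 4) % 4           ≡⟨ [m+kn]%n≡m%n 1 d 4 ⟩
  1                         ∎)
  where
  open ≡-Reasoning
  3≢1 : 3 ≢ 1
  3≢1 ()
  lhs : ∀ a b c → suc (4 * a) + (suc (4 * b) + (suc (4 * c) + 0)) ≡ 3 + (a + b + c) * 4
  lhs = ℕ-Solver.solve-∀
  rhs : ∀ d → suc (4 * d) + 0 ≡ 1 + d * 4
  rhs = ℕ-Solver.solve-∀

two≡two : ∀ i j l m → Balanced true true false false (firstCoord i) (firstCoord j) (firstCoord l) (firstCoord m) →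
          suc i + suc j ≡ suc l + suc m
two≡two i j l m balanced = begin
  suc i + suc j   ≡⟨ normal i j ⟩
  2 + (i + j)     ≡⟨ cong (λ s → 2 + s) (ℕₚ.*-cancelˡ-≡ (i + j) (l + m) 4 (ℕₚ.+-cancelˡ-≡ 2 _ _ scaled)) ⟩
  2 + (l + m)     ≡⟨ normal l m ⟨
  suc l + suc m   ∎
  where
  open ≡-Reasoning
  normal : ∀ x y → suc x + suc y ≡ 2 + (x + y)
  normal = ℕ-Solver.solve-∀
  scaled-normal : ∀ x y → suc (4 * x) + (suc (4 * y) + 0) ≡ 2 + 4 * (x + y)
  scaled-normal = ℕ-Solver.solve-∀
  scaled : 2 + 4 * (i + j) ≡ 2 + 4 * (l + m)
  scaled = trans (sym (scaled-normal i j)) (trans balanced (scaled-normal l m))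

balanced-pair : ∀ x y z w → Balanced true true false false x y z w → x + y ≡ z + w
balanced-pair x y z w balanced =
  trans (cong (λ s → x + s) (sym (ℕₚ.+-identityʳ y))) (trans balanced (cong (λ s → z + s) (ℕₚ.+-identityʳ w)))

pt-view : ∀ {p} .{{_ : NonZero p}} g j → pt p g (suc j) ≡ (+ firstCoord j , + (g ^ suc j % p))
pt-view {p} g j = cong (_, + (g ^ suc j % p)) (begin
  + (4 * suc j) ℤ.- + 3        ≡⟨ cong (λ x → + x ℤ.- + 3) (ℕₚ.*-suc 4 j) ⟩
  + (3 + firstCoord j) ℤ.- + 3 ≡⟨ ℤₚ.m-n≡m⊖n (3 + firstCoord j) 3 ⟩
  (3 + firstCoord j) ℤ.⊖ 3     ≡⟨ ℤₚ.+-cancelˡ-⊖ 3 (firstCoord j) 0 ⟩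
  + firstCoord j               ∎)
  where open ≡-Reasoning

module PrimitiveRoot {p : ℕ} (pp : Prime p) {g : ℕ} (prim : IsPrimitiveRoot p {{prime⇒nonZero pp}} g) where
  private instance
    p≢0 : NonZero p
    p≢0 = prime⇒nonZero pp

  res : ℕ → ℕ
  res k = g ^ k % p

  point : ℕ → Point
  point j = (+ firstCoord j , + res (suc j))

  res-+ : ∀ i j → (res i * res j) % p ≡ res (i + j)
  res-+ i j = trans (sym (%-distribˡ-* (g ^ i) (g ^ j) p)) (cong (_% p) (sym (ℕₚ.^-distribˡ-+-* g i j)))

  p∤g : ¬ p ∣ g
  p∤g p∣g = proj₁ prim (n∣m⇒m%n≡0 g p p∣g)

  -- g has order at least p − 1: if g^d ≡ 1 with d > 0, the d powers g^0, …, g^(d−1)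
  -- already represent all p − 1 nonzero residues.
  order≥ : ∀ {d} → 0 < d → res d ≡ 1 % p → p ∸ 1 ≤ d
  order≥ {d} 0<d gᵈ≡1 = injective⇒≤ {f = log} log-injective
    where
    reduced : (x : Fin (p ∸ 1)) → suc (toℕ x) % p ≡ suc (toℕ x)
    reduced x = m<n⇒m%n≡m (ℕₚ.pred-cancel-< (toℕ<n x))
    represent : (x : Fin (p ∸ 1)) → ∃[ m ] (m < d × res m ≡ suc (toℕ x))
    represent x with proj₂ prim (suc (toℕ x)) (λ v%p≡0 → ℕₚ.1+n≢0 (trans (sym (reduced x)) v%p≡0))
    ... | k , gᵏ≡v with powers-cycle g 0<d gᵈ≡1 k
    ...   | m , m<d , gᵏ≡gᵐ = m , m<d , trans (sym gᵏ≡gᵐ) (trans gᵏ≡v (reduced x))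
    log : Fin (p ∸ 1) → Fin d
    log x = fromℕ< (proj₁ (proj₂ (represent x)))
    log-injective : ∀ {x y} → log x ≡ log y → x ≡ y
    log-injective {x} {y} eq = toℕ-injective (ℕₚ.suc-injective (begin
      suc (toℕ x)             ≡⟨ proj₂ (proj₂ (represent x)) ⟨
      res (proj₁ (represent x)) ≡⟨ cong res same-exponent ⟩
      res (proj₁ (represent y)) ≡⟨ proj₂ (proj₂ (represent y)) ⟩
      suc (toℕ y)             ∎))
      where
      open ≡-Reasoning
      same-exponent : proj₁ (represent x) ≡ proj₁ (represent y)
      same-exponent = trans (sym (toℕ-fromℕ< _)) (trans (cong toℕ eq) (toℕ-fromℕ< _))

  -- g^i ≡ g^l with 1 ≤ i < l ≤ p − 1 is impossible: cancelling g^i gives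
  -- g^(l−i) ≡ 1 with 0 < l − i < p − 1.
  res-distinct : ∀ {i l} → 1 ≤ i → i < l → l ≤ p ∸ 1 → res i ≢ res l
  res-distinct {i} {l} 1≤i i<l l≤p-1 gⁱ≡gˡ =
    ℕₚ.<⇒≱ d<p-1 (order≥ (ℕₚ.m<n⇒0<n∸m i<l) gᵈ≡1)
    where
    open ≡-Reasoning
    d<p-1 : l ∸ i < p ∸ 1
    d<p-1 = ℕₚ.<-≤-trans (ℕₚ.∸-monoʳ-< 1≤i (ℕₚ.<⇒≤ i<l)) l≤p-1
    gᵈ≡1 : res (l ∸ i) ≡ 1 % p
    gᵈ≡1 = *-cancelˡ-% pp (g ^ (l ∸ i)) 1 (∤⇒∤^ pp p∤g i) (begin
      (g ^ i * g ^ (l ∸ i)) % p ≡⟨ cong (_% p) (ℕₚ.^-distribˡ-+-* g i (l ∸ i)) ⟨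
      g ^ (i + (l ∸ i)) % p     ≡⟨ cong res (ℕₚ.m+[n∸m]≡n (ℕₚ.<⇒≤ i<l)) ⟩
      res l                     ≡⟨ gⁱ≡gˡ ⟨
      res i                     ≡⟨ cong (_% p) (ℕₚ.*-identityʳ (g ^ i)) ⟨
      (g ^ i * 1) % p           ∎)

  res-injective : ∀ {i l} → 1 ≤ i → i ≤ p ∸ 1 → 1 ≤ l → l ≤ p ∸ 1 → res i ≡ res l → i ≡ l
  res-injective {i} {l} 1≤i i≤p-1 1≤l l≤p-1 gⁱ≡gˡ with ℕₚ.<-cmp i l
  ... | tri< i<l _ _ = ⊥-elim (res-distinct 1≤i i<l l≤p-1 gⁱ≡gˡ)
  ... | tri≈ _ i≡l _ = i≡l
  ... | tri> _ _ l<i = ⊥-elim (res-distinct 1≤l l<i i≤p-1 (sym gⁱ≡gˡ))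

  sums-determine : ∀ {i j l m} → 1 ≤ i → i ≤ p ∸ 1 → 1 ≤ l → l ≤ p ∸ 1 → 1 ≤ m → m ≤ p ∸ 1 →
                   i + j ≡ l + m → res i + res j ≡ res l + res m → i ≡ l ⊎ i ≡ m
  sums-determine {i} {j} {l} {m} 1≤i i≤p-1 1≤l l≤p-1 1≤m m≤p-1 index-sum residue-sum =
    Sum.map (λ p∣ → res-injective 1≤i i≤p-1 1≤l l≤p-1 (congruent l p∣))
            (λ p∣ → res-injective 1≤i i≤p-1 1≤m m≤p-1 (congruent m p∣))
            (two-roots pp (+ res i) (+ res j) (+ res l) (+ res m) sumℤ p∣CD-AB)
    where
    congruent : ∀ k → p ∣ ∣ + res i ℤ.- + res k ∣ → res i ≡ res k
    congruent k p∣ = trans (sym (m%n%n≡m%n (g ^ i) p)) (trans (∣-⇒%-≡ (res i) (res k) p∣) (m%n%n≡m%n (g ^ k) p))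
    sumℤ : + res i ℤ.+ + res j ≡ + res l ℤ.+ + res m
    sumℤ = trans (sym (ℤₚ.pos-+ (res i) (res j))) (trans (cong +_ residue-sum) (ℤₚ.pos-+ (res l) (res m)))
    products : (res l * res m) % p ≡ (res i * res j) % p
    products = trans (res-+ l m) (trans (cong res (sym index-sum)) (sym (res-+ i j)))
    p∣CD-AB : p ∣ ∣ + res l ℤ.* + res m ℤ.- + res i ℤ.* + res j ∣
    p∣CD-AB = subst (λ z → p ∣ ∣ z ∣) (cong₂ ℤ._-_ (ℤₚ.pos-* (res l) (res m)) (ℤₚ.pos-* (res i) (res j)))
                    (%-≡⇒∣- (res l * res m) (res i * res j) products)

  no-pair-collision : ∀ i j l m → i < p ∸ 1 → l < p ∸ 1 → m < p ∸ 1 → i ≢ l → i ≢ m →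
    Balanced true true false false (firstCoord i) (firstCoord j) (firstCoord l) (firstCoord m) →
    Balanced true true false false (res (suc i)) (res (suc j)) (res (suc l)) (res (suc m)) → ⊥
  no-pair-collision i j l m i< l< m< i≢l i≢m first second
    with sums-determine (s≤s z≤n) i< (s≤s z≤n) l< (s≤s z≤n) m<
           (two≡two i j l m first) (balanced-pair (res (suc i)) (res (suc j)) (res (suc l)) (res (suc m)) second)
  ... | inj₁ i+1≡l+1 = i≢l (ℕₚ.suc-injective i+1≡l+1)
  ... | inj₂ i+1≡m+1 = i≢m (ℕₚ.suc-injective i+1≡m+1)

  module _ {a b c d : ℕ} (a< : a < p ∸ 1) (b< : b < p ∸ 1) (c< : c < p ∸ 1) (d< : d < p ∸ 1)
           (a≢b : a ≢ b) (a≢c : a ≢ c) (a≢d : a ≢ d) where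

    -- No choice of signs balances four points of S' (indices a + 1, …, d + 1) in both
    -- coordinates: equal signs give a positive sum, three against one fails modulo 4,
    -- and two against two is a pair collision (with a put on the left).
    no-balanced-signs : ∀ s₁ s₂ s₃ s₄ →
      Balanced s₁ s₂ s₃ s₄ (firstCoord a) (firstCoord b) (firstCoord c) (firstCoord d) →
      Balanced s₁ s₂ s₃ s₄ (res (suc a)) (res (suc b)) (res (suc c)) (res (suc d)) → ⊥
    no-balanced-signs true  true  true  true  () _
    no-balanced-signs false false false false () _
    no-balanced-signs true  true  true  false first _ = three≢one a b c d first
    no-balanced-signs true  true  false true  first _ = three≢one a b d c first
    no-balanced-signs true  false true  true  first _ = three≢one a c d b first
    no-balanced-signs false true  true  true  first _ = three≢one b c d a first
    no-balanced-signs false false false true  first _ = three≢one a b c d (sym first)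
    no-balanced-signs false false true  false first _ = three≢one a b d c (sym first)
    no-balanced-signs false true  false false first _ = three≢one a c d b (sym first)
    no-balanced-signs true  false false false first _ = three≢one b c d a (sym first)
    no-balanced-signs true  true  false false first second = no-pair-collision a b c d a< c< d< a≢c a≢d first second
    no-balanced-signs false false true  true  first second = no-pair-collision a b c d a< c< d< a≢c a≢d (sym first) (sym second)
    no-balanced-signs true  false true  false first second = no-pair-collision a c b d a< b< d< a≢b a≢d first second
    no-balanced-signs false true  false true  first second = no-pair-collision a c b d a< b< d< a≢b a≢d (sym first) (sym second)
    no-balanced-signs true  false false true  first second = no-pair-collision a d b c a< b< c< a≢b a≢c first second
    no-balanced-signs false true  true  false first second = no-pair-collision a d b c a< b< c< a≢b a≢c (sym first) (sym second)

    four-points : ∀ s₁ s₂ s₃ s₄ →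
      (signedSum s₁ s₂ s₃ s₄ (point a) (point b) (point c) (point d) ≢ (ℤ.0ℤ , ℤ.0ℤ)) ×
      (∣ proj₁ (signedSum s₁ s₂ s₃ s₄ (point a) (point b) (point c) (point d)) ∣ ≤ 16 * p) ×
      (∣ proj₂ (signedSum s₁ s₂ s₃ s₄ (point a) (point b) (point c) (point d)) ∣ ≤ 4 * p)
    four-points s₁ s₂ s₃ s₄ =
        (λ vanishes → no-balanced-signs s₁ s₂ s₃ s₄
           (vanishing⇒balanced s₁ s₂ s₃ s₄ _ _ _ _ (cong proj₁ (trans (sym coords) vanishes)))
           (vanishing⇒balanced s₁ s₂ s₃ s₄ _ _ _ _ (cong proj₂ (trans (sym coords) vanishes))))
      , subst (λ x → ∣ x ∣ ≤ 16 * p) (sym (cong proj₁ coords)) (ℕₚ.≤-trans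
          (∣signedSumℤ∣≤ s₁ s₂ s₃ s₄ (proj₁ (point a)) (proj₁ (point b)) (proj₁ (point c)) (proj₁ (point d))
                         (4 * p) (first≤ a<) (first≤ b<) (first≤ c<) (first≤ d<))
          (ℕₚ.≤-reflexive (sym (ℕₚ.*-assoc 4 4 p))))
      , subst (λ x → ∣ x ∣ ≤ 4 * p) (sym (cong proj₂ coords))
          (∣signedSumℤ∣≤ s₁ s₂ s₃ s₄ (proj₂ (point a)) (proj₂ (point b)) (proj₂ (point c)) (proj₂ (point d))
                         p (res≤ (suc a)) (res≤ (suc b)) (res≤ (suc c)) (res≤ (suc d)))
      where
      firsts seconds : ℤ
      firsts  = signedSumℤ s₁ s₂ s₃ s₄ (proj₁ (point a)) (proj₁ (point b)) (proj₁ (point c)) (proj₁ (point d))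
      seconds = signedSumℤ s₁ s₂ s₃ s₄ (proj₂ (point a)) (proj₂ (point b)) (proj₂ (point c)) (proj₂ (point d))
      coords : signedSum s₁ s₂ s₃ s₄ (point a) (point b) (point c) (point d) ≡ (firsts , seconds)
      coords = signedSum-coords s₁ s₂ s₃ s₄ (point a) (point b) (point c) (point d)
      first≤ : ∀ {j} → j < p ∸ 1 → firstCoord j ≤ 4 * p
      first≤ j< = firstCoord≤ (ℕₚ.<-≤-trans j< (ℕₚ.m∸n≤m p 1))
      res≤ : ∀ k → res k ≤ p
      res≤ k = m%n≤n (g ^ k) p

-- Each point of S' is point j for an index j + 1 in 1, …, p − 1; distinct points have
-- distinct indices, and only the distinctness of a from b, c, d is needed.
mainTheorem9 : (p : ℕ) → (pp : Prime p) → (g : ℕ) →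
    IsPrimitiveRoot p {{prime⇒nonZero pp}} g →
    (a b c d : Point) →
    InS' p {{prime⇒nonZero pp}} g a → InS' p {{prime⇒nonZero pp}} g b →
    InS' p {{prime⇒nonZero pp}} g c → InS' p {{prime⇒nonZero pp}} g d →
    a ≢ b → a ≢ c → a ≢ d → b ≢ c → b ≢ d → c ≢ d →
    (s₁ s₂ s₃ s₄ : Bool) →
    (signedSum s₁ s₂ s₃ s₄ a b c d ≢ (ℤ.0ℤ , ℤ.0ℤ)) ×
    (∣ proj₁ (signedSum s₁ s₂ s₃ s₄ a b c d) ∣ ≤ 16 ℕ.* p) ×
    (∣ proj₂ (signedSum s₁ s₂ s₃ s₄ a b c d) ∣ ≤ 4 ℕ.* p)
mainTheorem9 p pp g prim ._ ._ ._ ._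
  (suc a , s≤s z≤n , a< , refl) (suc b , s≤s z≤n , b< , refl)
  (suc c , s≤s z≤n , c< , refl) (suc d , s≤s z≤n , d< , refl) a≢b a≢c a≢d _ _ _
  rewrite pt-view {{prime⇒nonZero pp}} g a | pt-view {{prime⇒nonZero pp}} g b
        | pt-view {{prime⇒nonZero pp}} g c | pt-view {{prime⇒nonZero pp}} g d
  = four-points a< b< c< d< (index≢ a≢b) (index≢ a≢c) (index≢ a≢d)
  where
  open PrimitiveRoot pp prim
  index≢ : ∀ {i j} → point i ≢ point j → i ≢ j
  index≢ point-i≢point-j i≡j = point-i≢point-j (cong point i≡j)
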